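{- For every BSR(SLI) clause set $N$ there is an equisatisfiable BSR(SLI) clause set $N'$ in normal form.
   Context: Two sorts are used: the base sort $\mathcal{Z}$, always interpreted as the integers, and a free sort $\mathcal{S}$. $V_\mathcal{Z}$, $V_\mathcal{S}$ are countably infinite sets of base-sort and free-sort variables. LIA terms are built from integer constants, $+,-$, base-sort variables, and base-sort Skolem constant symbols (integer-valued constants fixed by an interpretation). $\Omega$ is a finite set of free-sort constants, $\Pi$ a finite set of predicate symbols with sorted argument positions; $\approx$ is equality on $\mathcal{S}$. A BSR(SLI) clause $\Lambda \,\|\, \Gamma \to \Delta$ consists of multisets with: (i) atoms of $\Lambda$ are LIA constraints $s \triangleleft t$, $x \triangleleft t$ or $x \trianglelefteq y$ with $s,t$ ground LIA terms, $x,y$ base-sort variables, $\triangleleft\in\{<,\le,=,\neq,\ge,>\}$, $\trianglelefteq\in\{\le,=,\ge\}$; (ii) atoms of $\Gamma,\Delta$ are equations $s\approx s'$ with $s,s'\in\Omega\cup V_\mathcal{S}$ or atoms $P(s_1,\dots,s_m)$, $P\in\Pi$, whose base-sort arguments are base-sort variables and whose free-sort arguments are free-sort variables or constants in $\Omega$. It means $(\bigwedge\Lambda\wedge\bigwedge\Gamma)\to\bigvee\Delta$, universally closed. Hierarchic interpretations interpret $\mathcal{Z}$ as $\mathbb{Z}$ with standard arithmetic, assign integers to Skolem constants, and freely interpret $\mathcal{S}$ (nonempty), the constants in $\Omega$ and the predicates. Two clause sets are equisatisfiable if one has a hierarchic model iff the other has. A BSR(SLI) clause $\Lambda \,\|\,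 \Gamma\to\Delta$ is in normal form if (1) every non-ground atom in $\Lambda$ has the form $x \trianglelefteq c$ or $x \le y$ (or their symmetric variants), where $c$ is an integer constant or a Skolem constant and $\trianglelefteq\in\{\le,=,\ge\}$; (2) every base-sort variable occurring in $\Lambda$ also occurs in $\Gamma\to\Delta$; (3) $\Gamma$ contains no equation of the form $u\approx t$ with $u$ a free-sort variable. A clause set is in normal form if all its clauses are in normal form and pairwise variable-disjoint, and it contains at least one free-sort constant symbol. -}

module Defs where

open import Data.Nat using (ℕ)
open import Data.Integer using (ℤ; _+_; _-_; -_) renaming (_<_ to _<ℤ_; _≤_ to _≤ℤ_; _>_ to _>ℤ_; _≥_ to _≥ℤ_)
open import Data.List using (List; []; _∷_; _++_; length; lookup; concatMap)
open import Data.List.Relation.Unary.All using (All; []; _∷_)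
open import Data.List.Relation.Unary.Any using (Any)
open import Data.List.Membership.Propositional using (_∈_; _∉_)
open import Data.Fin using (Fin)
open import Data.Product using (Σ; _×_; _,_)
open import Data.Empty using (⊥)
open import Data.Unit using (⊤)
open import Relation.Nullary using (¬_)
open import Relation.Binary.PropositionalEquality using (_≡_; _≢_)
open import Function.Bundles using (_⇔_)

data Sort : Set where
  𝒵 𝒮 : Sort

-- Variables of either sort are indexed by ℕ (countably infinite supplies
-- V_𝒵 and V_𝒮).  Skolem constants (base sort), free-sort constants and
-- predicate names are also drawn from countably infinite supplies indexed
-- by ℕ; a clause set uses only finitely many of them, which are its Ω, Π.

data GTerm : Set where
  num  : ℤ → GTerm
  sk   : ℕ → GTerm
  _⊕_  : GTerm → GTerm → GTerm
  _⊖_  : GTerm → GTerm → GTerm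
  ⊝_   : GTerm → GTerm

data Rel : Set where
  lt le eq ne ge gt : Rel

data VRel : Set where
  vle veq vge : VRel

data LAtom : Set where
  gnd : GTerm → Rel → GTerm → LAtom
  vt  : ℕ → Rel → GTerm → LAtom
  vv  : ℕ → VRel → ℕ → LAtom

data FTerm : Set where
  fvar : ℕ → FTerm
  fcon : ℕ → FTerm

record PredSym : Set where
  constructor mkP
  field
    name  : ℕ
    sorts : List Sort
open PredSym public

ArgSyn : Sort → Set
ArgSyn 𝒵 = ℕ
ArgSyn 𝒮 = FTerm

data FAtom : Set where
  _≈_ : FTerm → FTerm → FAtom
  app : (P : PredSym) → All ArgSyn (sorts P) → FAtom

-- a clause Λ ∥ Γ → Δ  (multisets represented by lists)
record Clause : Set where
  constructor _∥_⇒_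
  field
    Λ : List LAtom
    Γ : List FAtom
    Δ : List FAtom
open Clause public

ClauseSet : Set
ClauseSet = List Clause

SortVal : Set → Sort → Set
SortVal U 𝒵 = ℤ
SortVal U 𝒮 = U

record Interp : Set₁ where
  field
    U    : Set
    u₀   : U                                   -- 𝒮 is nonempty
    skc  : ℕ → ℤ
    con  : ℕ → U
    prd  : (P : PredSym) → All (SortVal U) (sorts P) → Set
open Interp public

evalG : (ℕ → ℤ) → GTerm → ℤ
evalG α (num n) = n
evalG α (sk a)  = α a
evalG α (s ⊕ t) = evalG α s + evalG α t
evalG α (s ⊖ t) = evalG α s - evalG α t
evalG α (⊝ s)   = - evalG α s

relSem : Rel → ℤ → ℤ → Set
relSem lt a b = a <ℤ b
relSem le a b = a ≤ℤ b
relSem eq a b = a ≡ b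
relSem ne a b = a ≢ b
relSem ge a b = a ≥ℤ b
relSem gt a b = a >ℤ b

vrel : VRel → Rel
vrel vle = le
vrel veq = eq
vrel vge = ge

module _ (I : Interp) (β : ℕ → ℤ) (γ : ℕ → U I) where

  holdsL : LAtom → Set
  holdsL (gnd s r t) = relSem r (evalG (skc I) s) (evalG (skc I) t)
  holdsL (vt x r t)  = relSem r (β x) (evalG (skc I) t)
  holdsL (vv x r y)  = relSem (vrel r) (β x) (β y)

  evalF : FTerm → U I
  evalF (fvar u) = γ u
  evalF (fcon c) = con I c

  evalArg : ∀ {s} → ArgSyn s → SortVal (U I) s
  evalArg {𝒵} x = β x
  evalArg {𝒮} t = evalF t

  evalArgs : ∀ {ss} → All ArgSyn ss → All (SortVal (U I)) ss
  evalArgs []       = []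
  evalArgs (a ∷ as) = evalArg a ∷ evalArgs as

  holdsF : FAtom → Set
  holdsF (s ≈ t)    = evalF s ≡ evalF t
  holdsF (app P as) = prd I P (evalArgs as)

-- (⋀Λ ∧ ⋀Γ) → ⋁Δ, universally closed; read classically as
-- "no assignment makes all of Λ, Γ true and all of Δ false".
ClauseTrue : Interp → Clause → Set
ClauseTrue I C =
  (β : ℕ → ℤ) (γ : ℕ → U I) →
  All (holdsL I β γ) (Λ C) → All (holdsF I β γ) (Γ C) →
  All (λ A → ¬ holdsF I β γ A) (Δ C) → ⊥

Satisfiable : ClauseSet → Set₁
Satisfiable N = Σ Interp λ I → All (ClauseTrue I) N

Equisatisfiable : ClauseSet → ClauseSet → Set₁
Equisatisfiable N N' = Satisfiable N ⇔ Satisfiable N'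

SimpleTerm : GTerm → Set
SimpleTerm (num _) = ⊤
SimpleTerm (sk _)  = ⊤
SimpleTerm _       = ⊥

TriRel : Rel → Set
TriRel le = ⊤
TriRel eq = ⊤
TriRel ge = ⊤
TriRel _  = ⊥

NFAtom : LAtom → Set
NFAtom (gnd _ _ _) = ⊤
NFAtom (vt _ r t)  = TriRel r × SimpleTerm t
NFAtom (vv _ vle _) = ⊤
NFAtom (vv _ veq _) = ⊥
NFAtom (vv _ vge _) = ⊤

bvarsL : LAtom → List ℕ
bvarsL (gnd _ _ _) = []
bvarsL (vt x _ _)  = x ∷ []
bvarsL (vv x _ y)  = x ∷ y ∷ []

bvarsArgs : ∀ {ss} → All ArgSyn ss → List ℕ
bvarsArgs []             = []
bvarsArgs {𝒵 ∷ _} (x ∷ as) = x ∷ bvarsArgs as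
bvarsArgs {𝒮 ∷ _} (_ ∷ as) = bvarsArgs as

bvarsF : FAtom → List ℕ
bvarsF (_ ≈ _)    = []
bvarsF (app _ as) = bvarsArgs as

fvarsT : FTerm → List ℕ
fvarsT (fvar u) = u ∷ []
fvarsT (fcon _) = []

fvarsArgs : ∀ {ss} → All ArgSyn ss → List ℕ
fvarsArgs []               = []
fvarsArgs {𝒵 ∷ _} (_ ∷ as) = fvarsArgs as
fvarsArgs {𝒮 ∷ _} (t ∷ as) = fvarsT t ++ fvarsArgs as

fvarsF : FAtom → List ℕ
fvarsF (s ≈ t)    = fvarsT s ++ fvarsT t
fvarsF (app _ as) = fvarsArgs as

constsT : FTerm → List ℕ
constsT (fvar _) = []
constsT (fcon c) = c ∷ []

constsArgs : ∀ {ss} → All ArgSyn ss → List ℕ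
constsArgs []               = []
constsArgs {𝒵 ∷ _} (_ ∷ as) = constsArgs as
constsArgs {𝒮 ∷ _} (t ∷ as) = constsT t ++ constsArgs as

constsF : FAtom → List ℕ
constsF (s ≈ t)    = constsT s ++ constsT t
constsF (app _ as) = constsArgs as

bvarsC : Clause → List ℕ
bvarsC C = concatMap bvarsL (Λ C) ++ concatMap bvarsF (Γ C) ++ concatMap bvarsF (Δ C)

fvarsC : Clause → List ℕ
fvarsC C = concatMap fvarsF (Γ C) ++ concatMap fvarsF (Δ C)

constsC : Clause → List ℕ
constsC C = concatMap constsF (Γ C) ++ concatMap constsF (Δ C)

NoVarEq : FAtom → Set
NoVarEq (fvar _ ≈ _)      = ⊥
NoVarEq (fcon _ ≈ fvar _) = ⊥
NoVarEq (fcon _ ≈ fcon _) = ⊤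
NoVarEq (app _ _)         = ⊤

record NormalClause (C : Clause) : Set where
  field
    nf-atoms : All NFAtom (Λ C)
    nf-vars  : ∀ x → x ∈ concatMap bvarsL (Λ C) →
               x ∈ (concatMap bvarsF (Γ C) ++ concatMap bvarsF (Δ C))
    nf-eqs   : All NoVarEq (Γ C)

VariableDisjoint : ClauseSet → Set
VariableDisjoint N =
  (i j : Fin (length N)) → i ≢ j →
  (∀ x → x ∈ bvarsC (lookup N i) → x ∉ bvarsC (lookup N j)) ×
  (∀ u → u ∈ fvarsC (lookup N i) → u ∉ fvarsC (lookup N j))

HasFreeConstant : ClauseSet → Set
HasFreeConstant N = Σ ℕ λ c → Any (λ C → c ∈ constsC C) N

record NormalForm (N : ClauseSet) : Set where
  field
    nf-clauses  : All NormalClause N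
    nf-disjoint : VariableDisjoint N
    nf-const    : HasFreeConstant N

-- Each constraint x ◁ t is traded for x ⊴ c, where c is a fresh Skolem constant pinned to t, t − 1
-- or t + 1 by a ground clause  c ≠ t ∥ → ; a disequation x ≠ t splits its clause in two (x ≤ t − 1 or
-- x ≥ t + 1), and x = y becomes x ≤ y, x ≥ y.  An antecedent equation s ≈ t becomes E(s, t) for a fresh
-- predicate E axiomatised only as reflexive, and Top(x), axiomatised as always true, is added to the
-- antecedent for every base-sort variable x of the constraint part.  A model of N becomes a model of
-- the result by giving the fresh constants the values of their terms and reading E as equality;
-- conversely every model of the result, restricted to the original symbols, is a model of N, since
-- in an antecedent E(s, t) is only ever needed when s = t.  Renaming the variables x of clause k to
-- k + x K, with K larger than the number of clauses, makes the clauses variable-disjoint and is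
-- undone by division by K.

module Submission where

open import Defs
open import Data.Product using (Σ; _×_)

open import Data.Nat using (ℕ; zero; suc; _+_; _*_; _<_; _≤_; z<s; NonZero)
import Data.Nat.Properties as ℕP
open import Data.Nat.DivMod using (_/_; _%_; +-distrib-/-∣ʳ; m*n/n≡m; m<n⇒m/n≡0; [m+kn]%n≡m%n; m<n⇒m%n≡m)
open import Data.Nat.Divisibility using (divides-refl)
open import Data.Integer as ℤ using (ℤ; 0ℤ; 1ℤ; -1ℤ) renaming (_≤_ to _≤ℤ_; _<_ to _<ℤ_)
import Data.Integer.Properties as ℤP
open import Data.List using (List; []; _∷_; _++_; map; length; lookup; concatMap; cartesianProductWith)
open import Data.List.Properties using (map-++; concatMap-map; concatMap-cong; map-concatMap)
open import Data.List.Relation.Unary.All as All using (All; []; _∷_)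
import Data.List.Relation.Unary.All.Properties as AllP
open import Data.List.Relation.Unary.Any as Any using (Any; here; there)
import Data.List.Relation.Unary.Any.Properties as AnyP
open import Data.List.Membership.Propositional using (_∈_; _∉_; lose)
open import Data.List.Membership.Propositional.Properties using (∈-map⁺; ∈-map⁻)
open import Data.Fin using (Fin; toℕ)
import Data.Fin.Properties as FinP
open import Data.Product using (_,_; proj₁; proj₂; ∃)
open import Data.Sum as Sum using (_⊎_; inj₁; inj₂; [_,_])
open import Data.Empty using (⊥-elim)
open import Data.Unit using (⊤; tt)
open import Function using (_∘_; id)
open import Function.Bundles using (_⇔_; mk⇔; Equivalence)
import Function.Properties.Equivalence as ⇔
open import Data.Product.Function.NonDependent.Propositional using (_×-⇔_)
open import Data.Sum.Function.Propositional using (_⊎-⇔_)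
open import Relation.Nullary using (¬_)
open import Relation.Nullary.Decidable using (decidable-stable)
open import Relation.Nullary.Negation using (¬¬-Monad)
open import Effect.Monad using (RawMonad)
open import Relation.Binary.Definitions using (tri<; tri≈; tri>)
open import Relation.Binary.PropositionalEquality hiding ([_])

open Equivalence using (to; from)

≡⇒⇔ : ∀ {A B : Set} → A ≡ B → A ⇔ B
≡⇒⇔ refl = ⇔.refl

All-≡ : ∀ {A : Set} {P Q : A → Set} → (∀ a → P a ≡ Q a) → ∀ {xs} → All P xs ⇔ All Q xs
All-≡ e = mk⇔ (All.map (λ {a} → subst id (e a))) (All.map (λ {a} → subst id (sym (e a))))

All-map-≡ : ∀ {A B : Set} {P : B → Set} {Q : A → Set} (f : A → B) → (∀ a → P (f a) ≡ Q a) →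
            ∀ {xs} → All P (map f xs) ⇔ All Q xs
All-map-≡ f e = ⇔.trans (mk⇔ AllP.map⁻ AllP.map⁺) (All-≡ e)

¬¬-All : ∀ {A : Set} {P : A → Set} {xs} → All (λ x → ¬ ¬ P x) xs → ¬ ¬ All P xs
¬¬-All = All.sequenceA _ (RawMonad.rawApplicative ¬¬-Monad)

choices : ∀ {A : Set} → List (List (List A)) → List (List A)
choices []         = [] ∷ []
choices (xs ∷ xss) = cartesianProductWith _++_ xs (choices xss)

module _ {A : Set} {P : A → Set} where

  All-choices : ∀ {xss} → All (All (All P)) xss → All (All P) (choices xss)
  All-choices []                       = [] ∷ []
  All-choices {xs ∷ xss} (pxs ∷ pxss) =
    AllP.cartesianProductWith⁺ (setoid _) (setoid _) _++_ xs (choices xss)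
      (λ x∈ y∈ → AllP.++⁺ (All.lookup pxs x∈) (All.lookup (All-choices pxss) y∈))

  Any-All-choices : ∀ xss → Any (All P) (choices xss) ⇔ All (Any (All P)) xss
  Any-All-choices []         = mk⇔ (λ _ → []) (λ _ → here [])
  Any-All-choices (xs ∷ xss) = mk⇔
    (λ h → let p , q = AnyP.cartesianProductWith⁻ _++_ (λ {x} → AllP.++⁻ x) xs (choices xss) h
           in p ∷ to (Any-All-choices xss) q)
    (λ { (p ∷ ps) → AnyP.cartesianProductWith⁺ _++_ AllP.++⁺ p (from (Any-All-choices xss) ps) })

  Any-All-single : ∀ x → Any (All P) ((x ∷ []) ∷ []) ⇔ P x
  Any-All-single x = mk⇔ (λ { (here (p ∷ [])) → p ; (there ()) }) (λ p → here (p ∷ []))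

  Any-All-pair : ∀ x y → Any (All P) ((x ∷ []) ∷ (y ∷ []) ∷ []) ⇔ (P x ⊎ P y)
  Any-All-pair x y = mk⇔
    (λ { (here (p ∷ [])) → inj₁ p ; (there (here (q ∷ []))) → inj₂ q ; (there (there ())) })
    [ (λ p → here (p ∷ [])) , (λ q → there (here (q ∷ []))) ]

<⇔≤pred : ∀ {i j} → i <ℤ j ⇔ i ≤ℤ ℤ.pred j
<⇔≤pred = mk⇔ ℤP.i<j⇒i≤pred[j] ℤP.i≤pred[j]⇒i<j

<⇔suc≤ : ∀ {i j} → i <ℤ j ⇔ ℤ.suc i ≤ℤ j
<⇔suc≤ = mk⇔ ℤP.i<j⇒suc[i]≤j ℤP.suc[i]≤j⇒i<j

≢⇔≤pred⊎suc≤ : ∀ {i j} → i ≢ j ⇔ (i ≤ℤ ℤ.pred j ⊎ ℤ.suc j ≤ℤ i)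
≢⇔≤pred⊎suc≤ {i} {j} = mk⇔ split
  [ (λ p → ℤP.<⇒≢ (from <⇔≤pred p)) , (λ q → ≢-sym (ℤP.<⇒≢ (from <⇔suc≤ q))) ]
  where
  split : i ≢ j → i ≤ℤ ℤ.pred j ⊎ ℤ.suc j ≤ℤ i
  split i≢j with ℤP.<-cmp i j
  ... | tri< i<j _ _ = inj₁ (to <⇔≤pred i<j)
  ... | tri≈ _ i≡j _ = ⊥-elim (i≢j i≡j)
  ... | tri> _ _ j<i = inj₂ (to <⇔suc≤ j<i)

-- Old Skolem constants are moved to the even indices, the odd ones are fresh.
oldSk : ℕ → ℕ
oldSk zero    = zero
oldSk (suc a) = suc (suc (oldSk a))

freshSk : ℕ → ℕ
freshSk m = suc (oldSk m)

skolemSource : ℕ → ℕ ⊎ ℕ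
skolemSource zero          = inj₁ zero
skolemSource (suc zero)    = inj₂ zero
skolemSource (suc (suc n)) = Sum.map suc suc (skolemSource n)

skolemSource-oldSk : ∀ a → skolemSource (oldSk a) ≡ inj₁ a
skolemSource-oldSk zero    = refl
skolemSource-oldSk (suc a) = cong (Sum.map suc suc) (skolemSource-oldSk a)

skolemSource-freshSk : ∀ m → skolemSource (freshSk m) ≡ inj₂ m
skolemSource-freshSk zero    = refl
skolemSource-freshSk (suc m) = cong (Sum.map suc suc) (skolemSource-freshSk m)

mapSk : (ℕ → ℕ) → GTerm → GTerm
mapSk f (num n) = num n
mapSk f (sk a)  = sk (f a)
mapSk f (s ⊕ t) = mapSk f s ⊕ mapSk f t
mapSk f (s ⊖ t) = mapSk f s ⊖ mapSk f t
mapSk f (⊝ s)   = ⊝ mapSk f s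

evalG-mapSk : ∀ α f t → evalG α (mapSk f t) ≡ evalG (α ∘ f) t
evalG-mapSk α f (num n) = refl
evalG-mapSk α f (sk a)  = refl
evalG-mapSk α f (s ⊕ t) = cong₂ ℤ._+_ (evalG-mapSk α f s) (evalG-mapSk α f t)
evalG-mapSk α f (s ⊖ t) = cong₂ ℤ._-_ (evalG-mapSk α f s) (evalG-mapSk α f t)
evalG-mapSk α f (⊝ s)   = cong ℤ.-_ (evalG-mapSk α f s)

evalG-cong : ∀ {α α′ : ℕ → ℤ} → (∀ a → α a ≡ α′ a) → ∀ t → evalG α t ≡ evalG α′ t
evalG-cong e (num n) = refl
evalG-cong e (sk a)  = e a
evalG-cong e (s ⊕ t) = cong₂ ℤ._+_ (evalG-cong e s) (evalG-cong e t)
evalG-cong e (s ⊖ t) = cong₂ ℤ._-_ (evalG-cong e s) (evalG-cong e t)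
evalG-cong e (⊝ s)   = cong ℤ.-_ (evalG-cong e s)

predTerm sucTerm : GTerm → GTerm
predTerm t = num -1ℤ ⊕ t
sucTerm  t = num 1ℤ ⊕ t

TopP EqP : PredSym
TopP = mkP 0 (𝒵 ∷ [])
EqP  = mkP 1 (𝒮 ∷ 𝒮 ∷ [])

-- Predicate names 0 and 1 are reserved for TopP and EqP.
shiftP : PredSym → PredSym
shiftP P = mkP (2 + name P) (sorts P)

namedTerms : LAtom → List GTerm
namedTerms (vt _ lt t) = predTerm t ∷ []
namedTerms (vt _ le t) = t ∷ []
namedTerms (vt _ eq t) = t ∷ []
namedTerms (vt _ ne t) = predTerm t ∷ sucTerm t ∷ []
namedTerms (vt _ ge t) = t ∷ []
namedTerms (vt _ gt t) = sucTerm t ∷ []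
namedTerms _           = []

-- The fresh Skolem constants c, c + 1, … stand for the namedTerms of the atom.
alternatives : ℕ → LAtom → List (List LAtom)
alternatives c (gnd s r t)  = (gnd (mapSk oldSk s) r (mapSk oldSk t) ∷ []) ∷ []
alternatives c (vv x vle y) = (vv x vle y ∷ []) ∷ []
alternatives c (vv x veq y) = (vv x vle y ∷ vv x vge y ∷ []) ∷ []
alternatives c (vv x vge y) = (vv x vge y ∷ []) ∷ []
alternatives c (vt x lt t)  = (vt x le (sk (freshSk c)) ∷ []) ∷ []
alternatives c (vt x le t)  = (vt x le (sk (freshSk c)) ∷ []) ∷ []
alternatives c (vt x eq t)  = (vt x eq (sk (freshSk c)) ∷ []) ∷ []
alternatives c (vt x ne t)  = (vt x le (sk (freshSk c)) ∷ []) ∷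
                              (vt x ge (sk (freshSk (suc c))) ∷ []) ∷ []
alternatives c (vt x ge t)  = (vt x ge (sk (freshSk c)) ∷ []) ∷ []
alternatives c (vt x gt t)  = (vt x ge (sk (freshSk c)) ∷ []) ∷ []

alternativesΛ : ℕ → List LAtom → List (List (List LAtom))
alternativesΛ c []       = []
alternativesΛ c (L ∷ Λs) = alternatives c L ∷ alternativesΛ (c + length (namedTerms L)) Λs

top : ℕ → FAtom
top x = app TopP (x ∷ [])

hypothesisAtom : FAtom → FAtom
hypothesisAtom (s ≈ t)    = app EqP (s ∷ t ∷ [])
hypothesisAtom (app P as) = app (shiftP P) as

conclusionAtom : FAtom → FAtom
conclusionAtom (s ≈ t)    = s ≈ t
conclusionAtom (app P as) = app (shiftP P) as

withConstraints : Clause → List LAtom → Clause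
withConstraints C A =
  A ∥ (map top (concatMap bvarsL A) ++ map hypothesisAtom (Γ C)) ⇒ map conclusionAtom (Δ C)

namedTermsC : Clause → List GTerm
namedTermsC C = concatMap namedTerms (Λ C)

translateC : ℕ → Clause → ClauseSet
translateC c C = map (withConstraints C) (choices (alternativesΛ c (Λ C)))

translate : ℕ → ClauseSet → ClauseSet
translate c []      = []
translate c (C ∷ N) = translateC c C ++ translate (c + length (namedTermsC C)) N

definition : ℕ → GTerm → Clause
definition m t = (gnd (sk (freshSk m)) ne (mapSk oldSk t) ∷ []) ∥ [] ⇒ []

definitions : ℕ → List GTerm → ClauseSet
definitions m []       = []
definitions m (t ∷ ts) = definition m t ∷ definitions (suc m) ts

-- constantClause is a tautology; it only makes Ω nonempty.
constantClause reflexivityClause topClause : Clause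
constantClause    = [] ∥ [] ⇒ (fcon 0 ≈ fcon 0 ∷ [])
reflexivityClause = [] ∥ [] ⇒ (app EqP (fvar 0 ∷ fvar 0 ∷ []) ∷ [])
topClause         = [] ∥ [] ⇒ (top 0 ∷ [])

normalise : ClauseSet → ClauseSet
normalise N = constantClause ∷ reflexivityClause ∷ topClause ∷
              translate 0 N ++ definitions 0 (concatMap namedTermsC N)

module _ (ρ : ℕ → ℕ) where

  renameL : LAtom → LAtom
  renameL (gnd s r t) = gnd s r t
  renameL (vt x r t)  = vt (ρ x) r t
  renameL (vv x r y)  = vv (ρ x) r (ρ y)

  renameT : FTerm → FTerm
  renameT (fvar u) = fvar (ρ u)
  renameT (fcon c) = fcon c

  renameArgs : ∀ {ss} → All ArgSyn ss → All ArgSyn ss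
  renameArgs []                 = []
  renameArgs {𝒵 ∷ _} (x ∷ as) = ρ x ∷ renameArgs as
  renameArgs {𝒮 ∷ _} (t ∷ as) = renameT t ∷ renameArgs as

  renameF : FAtom → FAtom
  renameF (s ≈ t)    = renameT s ≈ renameT t
  renameF (app P as) = app P (renameArgs as)

  renameC : Clause → Clause
  renameC C = map renameL (Λ C) ∥ map renameF (Γ C) ⇒ map renameF (Δ C)

slot : ℕ → ℕ → ℕ → ℕ
slot K k x = k + x * K

separateFrom : ℕ → ℕ → ClauseSet → ClauseSet
separateFrom K k []      = []
separateFrom K k (C ∷ N) = renameC (slot K k) C ∷ separateFrom K (suc k) N

-- K exceeds every clause index k, so k and x are recovered from k + x * K by % and /.
separate : ClauseSet → ClauseSet
separate N = separateFrom (suc (length N)) 0 N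

alternatives-normal : ∀ c L → All (All NFAtom) (alternatives c L)
alternatives-normal c (gnd s r t)  = (tt ∷ []) ∷ []
alternatives-normal c (vv x vle y) = (tt ∷ []) ∷ []
alternatives-normal c (vv x veq y) = (tt ∷ tt ∷ []) ∷ []
alternatives-normal c (vv x vge y) = (tt ∷ []) ∷ []
alternatives-normal c (vt x lt t)  = ((tt , tt) ∷ []) ∷ []
alternatives-normal c (vt x le t)  = ((tt , tt) ∷ []) ∷ []
alternatives-normal c (vt x eq t)  = ((tt , tt) ∷ []) ∷ []
alternatives-normal c (vt x ne t)  = ((tt , tt) ∷ []) ∷ ((tt , tt) ∷ []) ∷ []
alternatives-normal c (vt x ge t)  = ((tt , tt) ∷ []) ∷ []
alternatives-normal c (vt x gt t)  = ((tt , tt) ∷ []) ∷ []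

alternativesΛ-normal : ∀ c Λs → All (All (All NFAtom)) (alternativesΛ c Λs)
alternativesΛ-normal c []       = []
alternativesΛ-normal c (L ∷ Λs) = alternatives-normal c L ∷ alternativesΛ-normal _ Λs

hypothesisAtom-noVarEq : ∀ A → NoVarEq (hypothesisAtom A)
hypothesisAtom-noVarEq (s ≈ t)    = tt
hypothesisAtom-noVarEq (app P as) = tt

withConstraints-normal : ∀ C {A} → All NFAtom A → NormalClause (withConstraints C A)
withConstraints-normal C nf = record
  { nf-atoms = nf
  ; nf-vars  = λ x x∈ → AnyP.++⁺ˡ (AnyP.concatMap⁺ bvarsF (AnyP.++⁺ˡ (AnyP.map⁺ (Any.map here x∈))))
  ; nf-eqs   = AllP.++⁺ (AllP.map⁺ (All.universal (λ _ → tt) _))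
                        (AllP.map⁺ (All.universal hypothesisAtom-noVarEq (Γ C)))
  }

translate-normal : ∀ c N → All NormalClause (translate c N)
translate-normal c []      = []
translate-normal c (C ∷ N) = AllP.++⁺ translateC-normal (translate-normal _ N)
  where
  translateC-normal : All NormalClause (translateC c C)
  translateC-normal =
    AllP.map⁺ (All.map (withConstraints-normal C) (All-choices (alternativesΛ-normal c (Λ C))))

definitions-normal : ∀ m ts → All NormalClause (definitions m ts)
definitions-normal m []       = []
definitions-normal m (t ∷ ts) =
  record { nf-atoms = tt ∷ [] ; nf-vars = λ _ () ; nf-eqs = [] } ∷ definitions-normal (suc m) ts

normalise-normal : ∀ N → All NormalClause (normalise N)
normalise-normal N = unit ∷ unit ∷ unit ∷ AllP.++⁺ (translate-normal 0 N) (definitions-normal 0 _)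
  where
  unit : ∀ {Δ} → NormalClause ([] ∥ [] ⇒ Δ)
  unit = record { nf-atoms = [] ; nf-vars = λ _ () ; nf-eqs = [] }

concatMap-map-≗ : ∀ {A B : Set} (ρ : ℕ → ℕ) {f : A → List ℕ} {g : B → List ℕ} {h : A → B} →
                  (∀ a → g (h a) ≡ map ρ (f a)) → ∀ xs → concatMap g (map h xs) ≡ map ρ (concatMap f xs)
concatMap-map-≗ ρ {f} {g} {h} e xs = begin
  concatMap g (map h xs)   ≡⟨ concatMap-map g h xs ⟩
  concatMap (g ∘ h) xs     ≡⟨ concatMap-cong e xs ⟩
  concatMap (map ρ ∘ f) xs ≡⟨ map-concatMap ρ f xs ⟨
  map ρ (concatMap f xs)   ∎
  where open ≡-Reasoning

++-map : ∀ (ρ : ℕ → ℕ) {xs ys xs′ ys′} → xs′ ≡ map ρ xs → ys′ ≡ map ρ ys → xs′ ++ ys′ ≡ map ρ (xs ++ ys)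
++-map ρ {xs} {ys} refl refl = sym (map-++ ρ xs ys)

module _ (ρ : ℕ → ℕ) where

  bvarsL-rename : ∀ L → bvarsL (renameL ρ L) ≡ map ρ (bvarsL L)
  bvarsL-rename (gnd s r t) = refl
  bvarsL-rename (vt x r t)  = refl
  bvarsL-rename (vv x r y)  = refl

  bvarsArgs-rename : ∀ {ss} (as : All ArgSyn ss) → bvarsArgs (renameArgs ρ as) ≡ map ρ (bvarsArgs as)
  bvarsArgs-rename []                 = refl
  bvarsArgs-rename {𝒵 ∷ _} (x ∷ as) = cong (ρ x ∷_) (bvarsArgs-rename as)
  bvarsArgs-rename {𝒮 ∷ _} (t ∷ as) = bvarsArgs-rename as

  bvarsF-rename : ∀ A → bvarsF (renameF ρ A) ≡ map ρ (bvarsF A)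
  bvarsF-rename (s ≈ t)    = refl
  bvarsF-rename (app P as) = bvarsArgs-rename as

  fvarsT-rename : ∀ t → fvarsT (renameT ρ t) ≡ map ρ (fvarsT t)
  fvarsT-rename (fvar u) = refl
  fvarsT-rename (fcon c) = refl

  fvarsArgs-rename : ∀ {ss} (as : All ArgSyn ss) → fvarsArgs (renameArgs ρ as) ≡ map ρ (fvarsArgs as)
  fvarsArgs-rename []                 = refl
  fvarsArgs-rename {𝒵 ∷ _} (x ∷ as) = fvarsArgs-rename as
  fvarsArgs-rename {𝒮 ∷ _} (t ∷ as) = ++-map ρ (fvarsT-rename t) (fvarsArgs-rename as)

  fvarsF-rename : ∀ A → fvarsF (renameF ρ A) ≡ map ρ (fvarsF A)
  fvarsF-rename (s ≈ t)    = ++-map ρ (fvarsT-rename s) (fvarsT-rename t)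
  fvarsF-rename (app P as) = fvarsArgs-rename as

  bvarsΛ-renameC : ∀ C → concatMap bvarsL (Λ (renameC ρ C)) ≡ map ρ (concatMap bvarsL (Λ C))
  bvarsΛ-renameC C = concatMap-map-≗ ρ bvarsL-rename (Λ C)

  bvarsΓΔ-renameC : ∀ C → concatMap bvarsF (Γ (renameC ρ C)) ++ concatMap bvarsF (Δ (renameC ρ C))
                          ≡ map ρ (concatMap bvarsF (Γ C) ++ concatMap bvarsF (Δ C))
  bvarsΓΔ-renameC C =
    ++-map ρ (concatMap-map-≗ ρ bvarsF-rename (Γ C)) (concatMap-map-≗ ρ bvarsF-rename (Δ C))

  bvarsC-renameC : ∀ C → bvarsC (renameC ρ C) ≡ map ρ (bvarsC C)
  bvarsC-renameC C = ++-map ρ (bvarsΛ-renameC C) (bvarsΓΔ-renameC C)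

  fvarsC-renameC : ∀ C → fvarsC (renameC ρ C) ≡ map ρ (fvarsC C)
  fvarsC-renameC C =
    ++-map ρ (concatMap-map-≗ ρ fvarsF-rename (Γ C)) (concatMap-map-≗ ρ fvarsF-rename (Δ C))

  renameL-normal : ∀ L → NFAtom L → NFAtom (renameL ρ L)
  renameL-normal (gnd s r t)  nf = nf
  renameL-normal (vt x r t)   nf = nf
  renameL-normal (vv x vle y) nf = nf
  renameL-normal (vv x vge y) nf = nf

  renameF-noVarEq : ∀ A → NoVarEq A → NoVarEq (renameF ρ A)
  renameF-noVarEq (fcon c ≈ fcon d) nv = nv
  renameF-noVarEq (app P as)        nv = nv

  renameC-normal : ∀ {C} → NormalClause C → NormalClause (renameC ρ C)
  renameC-normal {C} nf = record
    { nf-atoms = AllP.map⁺ (All.map (renameL-normal _) (NormalClause.nf-atoms nf))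
    ; nf-vars  = vars
    ; nf-eqs   = AllP.map⁺ (All.map (renameF-noVarEq _) (NormalClause.nf-eqs nf))
    }
    where
    vars : ∀ x → x ∈ concatMap bvarsL (Λ (renameC ρ C)) →
           x ∈ (concatMap bvarsF (Γ (renameC ρ C)) ++ concatMap bvarsF (Δ (renameC ρ C)))
    vars x x∈ with ∈-map⁻ ρ (subst (x ∈_) (bvarsΛ-renameC C) x∈)
    ... | y , y∈ , refl =
      subst (ρ y ∈_) (sym (bvarsΓΔ-renameC C)) (∈-map⁺ ρ (NormalClause.nf-vars nf y y∈))

separateFrom-normal : ∀ K k {N} → All NormalClause N → All NormalClause (separateFrom K k N)
separateFrom-normal K k []         = []
separateFrom-normal K k (nf ∷ nfs) = renameC-normal (slot K k) nf ∷ separateFrom-normal K (suc k) nfs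

separateFrom-length : ∀ K k N → length (separateFrom K k N) ≡ length N
separateFrom-length K k []      = refl
separateFrom-length K k (C ∷ N) = cong suc (separateFrom-length K (suc k) N)

slot-% : ∀ K .{{_ : NonZero K}} {k} y → k < K → slot K k y % K ≡ k
slot-% K {k} y k<K = trans ([m+kn]%n≡m%n k y K) (m<n⇒m%n≡m k<K)

slot-/ : ∀ K .{{_ : NonZero K}} {k} y → k < K → slot K k y / K ≡ y
slot-/ K {k} y k<K = trans (+-distrib-/-∣ʳ k (divides-refl y)) (cong₂ _+_ (m<n⇒m/n≡0 k<K) (m*n/n≡m y K))

separate-index< : ∀ N (i : Fin (length (separate N))) → toℕ i < suc (length N)
separate-index< N i =
  ℕP.m<n⇒m<1+n (subst (toℕ i <_) (separateFrom-length (suc (length N)) 0 N) (FinP.toℕ<n i))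

module _ (vars : Clause → List ℕ) (vars-renameC : ∀ ρ C → vars (renameC ρ C) ≡ map ρ (vars C)) where

  vars-separateFrom : ∀ K k N (i : Fin (length (separateFrom K k N))) {x} →
                      x ∈ vars (lookup (separateFrom K k N) i) → ∃ λ y → x ≡ slot K (k + toℕ i) y
  vars-separateFrom K k (C ∷ N) Fin.zero x∈
    with ∈-map⁻ (slot K k) (subst (_ ∈_) (vars-renameC (slot K k) C) x∈)
  ... | y , _ , x≡ = y , trans x≡ (cong (λ k′ → slot K k′ y) (sym (ℕP.+-identityʳ k)))
  vars-separateFrom K k (C ∷ N) (Fin.suc i) x∈ with vars-separateFrom K (suc k) N i x∈
  ... | y , x≡ = y , trans x≡ (cong (λ k′ → slot K k′ y) (sym (ℕP.+-suc k (toℕ i))))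

  separate-disjoint : ∀ N (i j : Fin (length (separate N))) → i ≢ j →
                      ∀ x → x ∈ vars (lookup (separate N) i) → x ∉ vars (lookup (separate N) j)
  separate-disjoint N i j i≢j x x∈i x∈j
    with vars-separateFrom (suc (length N)) 0 N i x∈i | vars-separateFrom (suc (length N)) 0 N j x∈j
  ... | y , refl | y′ , x≡ =
    i≢j (FinP.toℕ-injective (begin
      toℕ i                     ≡⟨ slot-% K y (separate-index< N i) ⟨
      slot K (toℕ i) y % K      ≡⟨ cong (_% K) x≡ ⟩
      slot K (toℕ j) y′ % K     ≡⟨ slot-% K y′ (separate-index< N j) ⟩
      toℕ j                     ∎))
    where
    K = suc (length N)
    open ≡-Reasoning

Counterexample : (I : Interp) → (ℕ → ℤ) → (ℕ → U I) → Clause → Set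
Counterexample I β γ C =
  All (holdsL I β γ) (Λ C) × All (holdsF I β γ) (Γ C) × All (λ A → ¬ holdsF I β γ A) (Δ C)

ClauseTrue-transfer : ∀ {I J : Interp} {C D} →
                      (∀ β γ → Counterexample J β γ D →
                               Σ (ℕ → ℤ) λ β′ → Σ (ℕ → U I) λ γ′ → Counterexample I β′ γ′ C) →
                      ClauseTrue I C → ClauseTrue J D
ClauseTrue-transfer f ct β γ hΛ hΓ hΔ =
  let β′ , γ′ , cΛ , cΓ , cΔ = f β γ (hΛ , hΓ , hΔ) in ct β′ γ′ cΛ cΓ cΔ

module _ (I : Interp) (ρ : ℕ → ℕ) {β β′ : ℕ → ℤ} {γ γ′ : ℕ → U I}
         (β≗ : ∀ x → β′ (ρ x) ≡ β x) (γ≗ : ∀ u → γ′ (ρ u) ≡ γ u) where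

  evalF-rename : ∀ t → evalF I β′ γ′ (renameT ρ t) ≡ evalF I β γ t
  evalF-rename (fvar u) = γ≗ u
  evalF-rename (fcon c) = refl

  evalArgs-rename : ∀ {ss} (as : All ArgSyn ss) → evalArgs I β′ γ′ (renameArgs ρ as) ≡ evalArgs I β γ as
  evalArgs-rename []                 = refl
  evalArgs-rename {𝒵 ∷ _} (x ∷ as) = cong₂ _∷_ (β≗ x) (evalArgs-rename as)
  evalArgs-rename {𝒮 ∷ _} (t ∷ as) = cong₂ _∷_ (evalF-rename t) (evalArgs-rename as)

  holdsL-rename : ∀ L → holdsL I β′ γ′ (renameL ρ L) ≡ holdsL I β γ L
  holdsL-rename (gnd s r t) = refl
  holdsL-rename (vt x r t)  = cong (λ v → relSem r v _) (β≗ x)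
  holdsL-rename (vv x r y)  = cong₂ (relSem (vrel r)) (β≗ x) (β≗ y)

  holdsF-rename : ∀ A → holdsF I β′ γ′ (renameF ρ A) ≡ holdsF I β γ A
  holdsF-rename (s ≈ t)    = cong₂ _≡_ (evalF-rename s) (evalF-rename t)
  holdsF-rename (app P as) = cong (prd I P) (evalArgs-rename as)

  counterexample-renameC : ∀ C → Counterexample I β′ γ′ (renameC ρ C) ⇔ Counterexample I β γ C
  counterexample-renameC C = All-map-≡ (renameL ρ) holdsL-rename
                         ×-⇔ All-map-≡ (renameF ρ) holdsF-rename
                         ×-⇔ All-map-≡ (renameF ρ) (λ A → cong ¬_ (holdsF-rename A))

ClauseTrue-renameC : ∀ I ρ C → ClauseTrue I C → ClauseTrue I (renameC ρ C)
ClauseTrue-renameC I ρ C = ClauseTrue-transfer λ β′ γ′ cx →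
  β′ ∘ ρ , γ′ ∘ ρ , to (counterexample-renameC I ρ (λ _ → refl) (λ _ → refl) C) cx

ClauseTrue-unrenameC : ∀ I ρ ρ⁻¹ → (∀ x → ρ⁻¹ (ρ x) ≡ x) →
                       ∀ C → ClauseTrue I (renameC ρ C) → ClauseTrue I C
ClauseTrue-unrenameC I ρ ρ⁻¹ inv C = ClauseTrue-transfer λ β γ cx →
  β ∘ ρ⁻¹ , γ ∘ ρ⁻¹ , from (counterexample-renameC I ρ (cong β ∘ inv) (cong γ ∘ inv) C) cx

separateFrom-sound : ∀ I K k {N} → All (ClauseTrue I) N → All (ClauseTrue I) (separateFrom K k N)
separateFrom-sound I K k []         = []
separateFrom-sound I K k (ct ∷ cts) =
  ClauseTrue-renameC I (slot K k) _ ct ∷ separateFrom-sound I K (suc k) cts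

separateFrom-complete : ∀ I K .{{_ : NonZero K}} k N → k + length N ≤ K →
                        All (ClauseTrue I) (separateFrom K k N) → All (ClauseTrue I) N
separateFrom-complete I K k []      _     []         = []
separateFrom-complete I K k (C ∷ N) fits (ct ∷ cts) =
  ClauseTrue-unrenameC I (slot K k) (_/ K) (λ y → slot-/ K y k<K) C ct
  ∷ separateFrom-complete I K (suc k) N (subst (_≤ K) (ℕP.+-suc k (length N)) fits) cts
  where
  k<K : k < K
  k<K = ℕP.<-≤-trans (ℕP.m<m+n k {suc (length N)} z<s) fits

separate-equisat : ∀ N → Equisatisfiable N (separate N)
separate-equisat N = mk⇔
  (λ (I , model) → I , separateFrom-sound I _ 0 model)
  (λ (I , model) → I , separateFrom-complete I (suc (length N)) 0 N (ℕP.n≤1+n _) model)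

module _ (I : Interp) (s : ℕ → ℤ) (p : (P : PredSym) → All (SortVal (U I)) (sorts P) → Set)
         (β : ℕ → ℤ) (γ : ℕ → U I) where

  evalF-update : ∀ t → evalF (record I { skc = s ; prd = p }) β γ t ≡ evalF I β γ t
  evalF-update (fvar u) = refl
  evalF-update (fcon c) = refl

  evalArgs-update : ∀ {ss} (as : All ArgSyn ss) →
                    evalArgs (record I { skc = s ; prd = p }) β γ as ≡ evalArgs I β γ as
  evalArgs-update []                 = refl
  evalArgs-update {𝒵 ∷ _} (x ∷ as) = cong (_ ∷_) (evalArgs-update as)
  evalArgs-update {𝒮 ∷ _} (t ∷ as) = cong₂ _∷_ (evalF-update t) (evalArgs-update as)

withSkolems : Interp → (ℕ → ℤ) → Interp
withSkolems I s = record I { skc = s }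

ClauseTrue-withSkolems : ∀ I {s} → (∀ a → skc I a ≡ s a) →
                         ∀ C → ClauseTrue I C → ClauseTrue (withSkolems I s) C
ClauseTrue-withSkolems I {s} s≗ C = ClauseTrue-transfer λ β γ cx → β , γ , to (counterexample β γ C) cx
  where
  holdsL-withSkolems : ∀ β γ L → holdsL (withSkolems I s) β γ L ≡ holdsL I β γ L
  holdsL-withSkolems β γ (gnd a r t) = sym (cong₂ (relSem r) (evalG-cong s≗ a) (evalG-cong s≗ t))
  holdsL-withSkolems β γ (vt x r t)  = sym (cong (relSem r (β x)) (evalG-cong s≗ t))
  holdsL-withSkolems β γ (vv x r y)  = refl

  holdsF-withSkolems : ∀ β γ A → holdsF (withSkolems I s) β γ A ≡ holdsF I β γ A
  holdsF-withSkolems β γ (a ≈ b)    =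
    cong₂ _≡_ (evalF-update I s (prd I) β γ a) (evalF-update I s (prd I) β γ b)
  holdsF-withSkolems β γ (app P as) = cong (prd I P) (evalArgs-update I s (prd I) β γ as)

  counterexample : ∀ β γ C → Counterexample (withSkolems I s) β γ C ⇔ Counterexample I β γ C
  counterexample β γ C = All-≡ (holdsL-withSkolems β γ)
                     ×-⇔ All-≡ (holdsF-withSkolems β γ)
                     ×-⇔ All-≡ (λ A → cong ¬_ (holdsF-withSkolems β γ A))

restrict : Interp → Interp
restrict I = record I { skc = skc I ∘ oldSk ; prd = λ P → prd I (shiftP P) }

nth : List GTerm → ℕ → GTerm
nth []       _       = num 0ℤ
nth (t ∷ ts) zero    = t
nth (t ∷ ts) (suc m) = nth ts m

extendedPrd : (I : Interp) (P : PredSym) → All (SortVal (U I)) (sorts P) → Set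
extendedPrd I (mkP 0 _)                    _            = ⊤
extendedPrd I (mkP 1 (𝒮 ∷ 𝒮 ∷ []))         (a ∷ b ∷ []) = a ≡ b
extendedPrd I (mkP 1 _)                    _            = ⊤
extendedPrd I (mkP (suc (suc n)) ss)       as           = prd I (mkP n ss) as

extend : Interp → List GTerm → Interp
extend I ts = record I
  { skc = [ skc I , (λ m → evalG (skc I) (nth ts m)) ] ∘ skolemSource
  ; prd = extendedPrd I
  }

extend-oldSk : ∀ I ts a → skc I a ≡ skc (extend I ts) (oldSk a)
extend-oldSk I ts a = sym (cong [ skc I , _ ] (skolemSource-oldSk a))

Names : (ℕ → ℤ) → ℕ → List GTerm → Set
Names s c []       = ⊤
Names s c (t ∷ ts) = s (freshSk c) ≡ evalG (s ∘ oldSk) t × Names s (suc c) ts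

Names-++⁻ : ∀ {s c} ts {us} → Names s c (ts ++ us) → Names s c ts × Names s (c + length ts) us
Names-++⁻ {s} {c} []       {us} n        = tt , subst (λ c′ → Names s c′ us) (sym (ℕP.+-identityʳ c)) n
Names-++⁻ {s} {c} (t ∷ ts) {us} (e , n) =
  let n₁ , n₂ = Names-++⁻ ts n
  in (e , n₁) , subst (λ c′ → Names s c′ us) (sym (ℕP.+-suc c (length ts))) n₂

Names-extend : ∀ I ts₀ c ts → (∀ k → nth ts₀ (c + k) ≡ nth ts k) → Names (skc (extend I ts₀)) c ts
Names-extend I ts₀ c []       _      = tt
Names-extend I ts₀ c (t ∷ ts) suffix = named , Names-extend I ts₀ (suc c) ts suffix′
  where
  open ≡-Reasoning
  named : skc (extend I ts₀) (freshSk c) ≡ evalG (skc (extend I ts₀) ∘ oldSk) t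
  named = begin
    skc (extend I ts₀) (freshSk c)         ≡⟨ cong [ skc I , _ ] (skolemSource-freshSk c) ⟩
    evalG (skc I) (nth ts₀ c)              ≡⟨ cong (evalG (skc I) ∘ nth ts₀) (ℕP.+-identityʳ c) ⟨
    evalG (skc I) (nth ts₀ (c + 0))        ≡⟨ cong (evalG (skc I)) (suffix 0) ⟩
    evalG (skc I) t                        ≡⟨ evalG-cong (extend-oldSk I ts₀) t ⟩
    evalG (skc (extend I ts₀) ∘ oldSk) t   ∎
  suffix′ : ∀ k → nth ts₀ (suc c + k) ≡ nth ts k
  suffix′ k = trans (cong (nth ts₀) (sym (ℕP.+-suc c k))) (suffix (suc k))

module _ (I : Interp) (β : ℕ → ℤ) (γ : ℕ → U I) where

  holdsF-restrict : ∀ A → holdsF (restrict I) β γ A ≡ holdsF I β γ (conclusionAtom A)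
  holdsF-restrict (a ≈ b)    = cong₂ _≡_ (evalF-update I _ _ β γ a) (evalF-update I _ _ β γ b)
  holdsF-restrict (app P as) = cong (prd I (shiftP P)) (evalArgs-update I _ _ β γ as)

  conclusions-restrict : ∀ {As} → All (λ A → ¬ holdsF I β γ A) (map conclusionAtom As) ⇔
                                  All (λ A → ¬ holdsF (restrict I) β γ A) As
  conclusions-restrict = All-map-≡ conclusionAtom λ A → cong ¬_ (sym (holdsF-restrict A))

  hypothesis-restrict : (∀ a b → prd I EqP (a ∷ b ∷ []) → a ≡ b) →
                        ∀ A → holdsF I β γ (hypothesisAtom A) → holdsF (restrict I) β γ A
  hypothesis-restrict eq⇒≡ (a ≈ b)    h = subst id (sym (holdsF-restrict (a ≈ b))) (eq⇒≡ _ _ h)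
  hypothesis-restrict eq⇒≡ (app P as) h = subst id (sym (holdsF-restrict (app P as))) h

  -- Facts obtained from clauses of the translation hold only up to double negation.
  hypothesis-¬¬ : (∀ a → ¬ ¬ prd I EqP (a ∷ a ∷ [])) →
                  ∀ A → holdsF (restrict I) β γ A → ¬ ¬ holdsF I β γ (hypothesisAtom A)
  hypothesis-¬¬ refl¬¬ (a ≈ b)    h = subst (λ v → ¬ ¬ prd I EqP (evalF I β γ a ∷ v ∷ []))
                                          (subst id (holdsF-restrict (a ≈ b)) h) (refl¬¬ _)
  hypothesis-¬¬ refl¬¬ (app P as) h = λ ¬h → ¬h (subst id (holdsF-restrict (app P as)) h)

  private
    single : ∀ {A : Set} {L} → A ⇔ holdsL I β γ L → A ⇔ Any (All (holdsL I β γ)) ((L ∷ []) ∷ [])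
    single e = ⇔.trans e (⇔.sym (Any-All-single _))

    named : ∀ r x {n v} → skc I n ≡ v → relSem r (β x) v ⇔ holdsL I β γ (vt x r (sk n))
    named r x e = ≡⇒⇔ (cong (relSem r (β x)) (sym e))

  alternatives-⇔ : ∀ c L → Names (skc I) c (namedTerms L) →
                   holdsL (restrict I) β γ L ⇔ Any (All (holdsL I β γ)) (alternatives c L)
  alternatives-⇔ c (gnd a r t) _ =
    single (≡⇒⇔ (sym (cong₂ (relSem r) (evalG-mapSk (skc I) oldSk a) (evalG-mapSk (skc I) oldSk t))))
  alternatives-⇔ c (vv x vle y) _ = single ⇔.refl
  alternatives-⇔ c (vv x veq y) _ = mk⇔
    (λ e → here (ℤP.≤-reflexive e ∷ ℤP.≤-reflexive (sym e) ∷ []))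
    (λ { (here (p ∷ q ∷ [])) → ℤP.≤-antisym p q ; (there ()) })
  alternatives-⇔ c (vv x vge y) _        = single ⇔.refl
  alternatives-⇔ c (vt x lt t) (e , _)    = single (⇔.trans <⇔≤pred (named le x e))
  alternatives-⇔ c (vt x le t) (e , _)    = single (named le x e)
  alternatives-⇔ c (vt x eq t) (e , _)    = single (named eq x e)
  alternatives-⇔ c (vt x ne t) (e , e′ , _) =
    ⇔.trans ≢⇔≤pred⊎suc≤ (⇔.trans (named le x e ⊎-⇔ named ge x e′) (⇔.sym (Any-All-pair _ _)))
  alternatives-⇔ c (vt x ge t) (e , _)    = single (named ge x e)
  alternatives-⇔ c (vt x gt t) (e , _)    = single (⇔.trans <⇔suc≤ (named ge x e))

  alternativesΛ-⇔ : ∀ c Λs → Names (skc I) c (concatMap namedTerms Λs) →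
                    All (holdsL (restrict I) β γ) Λs ⇔
                    All (Any (All (holdsL I β γ))) (alternativesΛ c Λs)
  alternativesΛ-⇔ c []       _     = mk⇔ (λ _ → []) (λ _ → [])
  alternativesΛ-⇔ c (L ∷ Λs) names = mk⇔
    (λ { (h ∷ hs) → to   atom h ∷ to   rest hs })
    (λ { (h ∷ hs) → from atom h ∷ from rest hs })
    where
    split = Names-++⁻ (namedTerms L) names
    atom  = alternatives-⇔ c L (proj₁ split)
    rest  = alternativesΛ-⇔ _ Λs (proj₂ split)

module _ (I : Interp) where

  translateC-sound : (∀ a b → prd I EqP (a ∷ b ∷ []) → a ≡ b) →
                     ∀ c C → Names (skc I) c (namedTermsC C) →
                     ClauseTrue (restrict I) C → All (ClauseTrue I) (translateC c C)
  translateC-sound eq⇒≡ c C names ct = AllP.map⁺ (All.tabulate λ {A} A∈ β γ hA hΓ hΔ →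
    ct β γ (from (alternativesΛ-⇔ I β γ c (Λ C) names) (to (Any-All-choices _) (lose A∈ hA)))
           (All.map (λ {B} → hypothesis-restrict I β γ eq⇒≡ B)
                    (AllP.map⁻ (AllP.++⁻ʳ (map top (concatMap bvarsL A)) hΓ)))
           (to (conclusions-restrict I β γ) hΔ))

  translateC-complete : (∀ z → ¬ ¬ prd I TopP (z ∷ [])) → (∀ a → ¬ ¬ prd I EqP (a ∷ a ∷ [])) →
                        ∀ c C → Names (skc I) c (namedTermsC C) →
                        All (ClauseTrue I) (translateC c C) → ClauseTrue (restrict I) C
  translateC-complete top¬¬ refl¬¬ c C names h β γ hΛ hΓ hΔ =
    ¬¬-All (AllP.++⁺ tops (AllP.map⁺ (All.map (λ {B} → hypothesis-¬¬ I β γ refl¬¬ B) hΓ)))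
      λ hΓ′ → ctA β γ hA hΓ′ (from (conclusions-restrict I β γ) hΔ)
    where
    choice : Any (All (holdsL I β γ)) (choices (alternativesΛ c (Λ C)))
    choice = from (Any-All-choices _) (to (alternativesΛ-⇔ I β γ c (Λ C) names) hΛ)
    A   = Any.lookup choice
    ctA = proj₁ (All.lookupAny (AllP.map⁻ h) choice)
    hA  = proj₂ (All.lookupAny (AllP.map⁻ h) choice)

    tops : All (λ F → ¬ ¬ holdsF I β γ F) (map top (concatMap bvarsL A))
    tops = AllP.map⁺ (All.universal (λ x → top¬¬ (β x)) _)

  translate-sound : (∀ a b → prd I EqP (a ∷ b ∷ []) → a ≡ b) →
                    ∀ c N → Names (skc I) c (concatMap namedTermsC N) →
                    All (ClauseTrue (restrict I)) N → All (ClauseTrue I) (translate c N)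
  translate-sound eq⇒≡ c []      _     []         = []
  translate-sound eq⇒≡ c (C ∷ N) names (ct ∷ cts) =
    let nC , nN = Names-++⁻ (namedTermsC C) names
    in AllP.++⁺ (translateC-sound eq⇒≡ c C nC ct) (translate-sound eq⇒≡ _ N nN cts)

  translate-complete : (∀ z → ¬ ¬ prd I TopP (z ∷ [])) → (∀ a → ¬ ¬ prd I EqP (a ∷ a ∷ [])) →
                       ∀ c N → Names (skc I) c (concatMap namedTermsC N) →
                       All (ClauseTrue I) (translate c N) → All (ClauseTrue (restrict I)) N
  translate-complete top¬¬ refl¬¬ c []      _     _ = []
  translate-complete top¬¬ refl¬¬ c (C ∷ N) names h =
    let nC , nN = Names-++⁻ (namedTermsC C) names
        hC , hN = AllP.++⁻ (translateC c C) h
    in translateC-complete top¬¬ refl¬¬ c C nC hC ∷ translate-complete top¬¬ refl¬¬ _ N nN hN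

  definition-⇔ : ∀ m t → ClauseTrue I (definition m t) ⇔ skc I (freshSk m) ≡ evalG (skc I ∘ oldSk) t
  definition-⇔ m t = mk⇔
    (λ ct → decidable-stable (_ ℤ.≟ _) λ ≢ →
      ct (λ _ → 0ℤ) (λ _ → u₀ I) ((λ e → ≢ (trans e (evalG-mapSk (skc I) oldSk t))) ∷ []) [] [])
    (λ e β γ → λ { (≢ ∷ []) _ _ → ≢ (trans e (sym (evalG-mapSk (skc I) oldSk t))) })

  definitions-⇔ : ∀ m ts → All (ClauseTrue I) (definitions m ts) ⇔ Names (skc I) m ts
  definitions-⇔ m []       = mk⇔ (λ _ → tt) (λ _ → [])
  definitions-⇔ m (t ∷ ts) = mk⇔
    (λ { (d ∷ ds) → to (definition-⇔ m t) d , to (definitions-⇔ (suc m) ts) ds })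
    (λ { (e , es) → from (definition-⇔ m t) e ∷ from (definitions-⇔ (suc m) ts) es })

normalise-sound : ∀ N → Satisfiable N → Satisfiable (normalise N)
normalise-sound N (I , model) = I′ ,
  (λ { _ _ _ _ (¬c≈c ∷ []) → ¬c≈c refl }) ∷
  (λ { _ _ _ _ (¬u≈u ∷ []) → ¬u≈u refl }) ∷
  (λ { _ _ _ _ (¬top ∷ []) → ¬top tt }) ∷
  AllP.++⁺ (translate-sound I′ (λ _ _ → id) 0 N names model′) (from (definitions-⇔ I′ 0 ts) names)
  where
  ts     = concatMap namedTermsC N
  I′     = extend I ts
  names  = Names-extend I ts 0 ts (λ _ → refl)
  model′ = All.map (λ {C} → ClauseTrue-withSkolems I (extend-oldSk I ts) C) model

normalise-complete : ∀ N → Satisfiable (normalise N) → Satisfiable N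
normalise-complete N (I , _ ∷ reflexivityAxiom ∷ topAxiom ∷ rest) =
  restrict I , translate-complete I top¬¬ refl¬¬ 0 N (to (definitions-⇔ I 0 _) defs) translated
  where
  translated = proj₁ (AllP.++⁻ (translate 0 N) rest)
  defs       = proj₂ (AllP.++⁻ (translate 0 N) rest)
  top¬¬ : ∀ z → ¬ ¬ prd I TopP (z ∷ [])
  top¬¬ z ¬top = topAxiom (λ _ → z) (λ _ → u₀ I) [] [] (¬top ∷ [])
  refl¬¬ : ∀ a → ¬ ¬ prd I EqP (a ∷ a ∷ [])
  refl¬¬ a ¬refl = reflexivityAxiom (λ _ → 0ℤ) (λ _ → a) [] [] (¬refl ∷ [])

normalise-equisat : ∀ N → Equisatisfiable N (normalise N)
normalise-equisat N = mk⇔ (normalise-sound N) (normalise-complete N)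

lemma1 : (N : ClauseSet) → Σ ClauseSet (λ N' → NormalForm N' × Equisatisfiable N N')
lemma1 N =
  separate (normalise N) , normalForm , ⇔.trans (normalise-equisat N) (separate-equisat (normalise N))
  where
  normalForm : NormalForm (separate (normalise N))
  normalForm = record
    { nf-clauses  = separateFrom-normal _ 0 (normalise-normal N)
    ; nf-disjoint = λ i j i≢j → separate-disjoint bvarsC bvarsC-renameC (normalise N) i j i≢j
                              , separate-disjoint fvarsC fvarsC-renameC (normalise N) i j i≢j
    ; nf-const    = 0 , here (here refl)
    }
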